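{- Let $\mathcal{M}$ be a pure oriented matroid. Then any oriented matroid obtained from $\mathcal{M}$ by adding (or removing) loops and coloops is pure.
   Context: An oriented matroid $\mathcal{M}$ on a finite set $E$ is given by its set of circuits (signed subsets $X=(X^+,X^-)$ satisfying the circuit axioms). $e\in E$ is a loop if $(\{e\},\emptyset)$ is a circuit, and a coloop if $e$ lies in the support of no circuit. Adding a loop $f$ means passing to the oriented matroid on $E\sqcup\{f\}$ whose circuits are those of $\mathcal{M}$ together with $(\{f\},\emptyset)$ and $(\emptyset,\{f\})$; adding a coloop $f$ means passing to the oriented matroid on $E\sqcup\{f\}$ with the same circuits. Removing $e$ means deletion: the oriented matroid on $E\setminus\{e\}$ whose circuits are the circuits of $\mathcal{M}$ whose support avoids $e$. Two sets $I,J\subseteq E$ are $\mathcal{M}$-separated if there is no circuit $X$ with $X^+\subseteq I\setminus J$, $X^-\subseteq J\setminus I$; a collection is $\mathcal{M}$-separated if its elements are pairwise $\mathcal{M}$-separated. $\mathcal{M}$ is pure if every $\mathcal{M}$-separated collection that is maximal by inclusion has maximum cardinality among all $\mathcal{M}$-separated collections. -}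

module Defs where

open import Data.Nat using (ℕ; suc; _≤_)
open import Data.Fin using (Fin)
open import Data.Fin.Subset using (Subset; _∈_; _∉_)
open import Data.Vec using (Vec; lookup; map; insertAt; replicate; _[_]≔_)
open import Data.List using (List; length)
open import Data.List.Membership.Propositional using () renaming (_∈_ to _∈ₗ_; _∉_ to _∉ₗ_)
open import Data.List.Relation.Binary.Subset.Propositional using () renaming (_⊆_ to _⊆ₗ_)
open import Data.List.Relation.Unary.Unique.Propositional using (Unique)
open import Data.Product using (Σ; _×_; ∃)
open import Data.Sum using (_⊎_)
open import Relation.Binary.PropositionalEquality using (_≡_; _≢_)
open import Relation.Nullary using (¬_)
open import Function.Bundles using (_⇔_)

-- Signs; a signed subset X = (X⁺, X⁻) of the ground set Fin n is a
-- sign vector: X⁺ = {e | X e = +}, X⁻ = {e | X e = -}.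
data Sign : Set where
  pos neg zer : Sign

opp : Sign → Sign
opp pos = neg
opp neg = pos
opp zer = zer

SignVec : ℕ → Set
SignVec n = Vec Sign n

negV : ∀ {n} → SignVec n → SignVec n
negV = map opp

record OM (n : ℕ) : Set₁ where
  field
    Circ : SignVec n → Set
    C0 : ¬ Circ (replicate n zer)
    C1 : ∀ X → Circ X → Circ (negV X)
    C2 : ∀ X Y → Circ X → Circ Y →
         (∀ e → lookup X e ≢ zer → lookup Y e ≢ zer) →
         X ≡ Y ⊎ X ≡ negV Y
    C3 : ∀ X Y e → Circ X → Circ Y → X ≢ negV Y →
         lookup X e ≡ pos → lookup Y e ≡ neg →
         Σ (SignVec n) λ Z → Circ Z × lookup Z e ≡ zer ×
           (∀ f → (lookup Z f ≡ pos → lookup X f ≡ pos ⊎ lookup Y f ≡ pos)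
                × (lookup Z f ≡ neg → lookup X f ≡ neg ⊎ lookup Y f ≡ neg))

open OM public

module _ {n : ℕ} (M : OM n) where

  IsLoop : Fin n → Set
  IsLoop e = Circ M (replicate n zer [ e ]≔ pos)

  IsColoop : Fin n → Set
  IsColoop e = ∀ X → Circ M X → lookup X e ≡ zer

  Separated : Subset n → Subset n → Set
  Separated I J = ¬ Σ (SignVec n) λ X → Circ M X ×
    (∀ e → lookup X e ≡ pos → e ∈ I × e ∉ J) ×
    (∀ e → lookup X e ≡ neg → e ∈ J × e ∉ I)

  SepColl : List (Subset n) → Set
  SepColl C = ∀ I J → I ∈ₗ C → J ∈ₗ C → Separated I J

  MaximalSep : List (Subset n) → Set
  MaximalSep C = SepColl C ×
    (∀ D → Unique D → SepColl D → C ⊆ₗ D → D ⊆ₗ C)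

  Pure : Set
  Pure = ∀ C → Unique C → MaximalSep C →
         ∀ D → Unique D → SepColl D → length D ≤ length C

-- One elementary operation. The new / removed element sits at an
-- arbitrary position i of the ground set Fin (suc n); the remaining
-- elements keep their order.
data Step : ∀ {n m} → OM n → OM m → Set₁ where
  addLoop : ∀ {n} (M : OM n) (N : OM (suc n)) (i : Fin (suc n)) →
    (∀ X → Circ N X ⇔
       ((Σ (SignVec n) λ Y → X ≡ insertAt Y i zer × Circ M Y)
        ⊎ X ≡ insertAt (replicate n zer) i pos
        ⊎ X ≡ insertAt (replicate n zer) i neg)) →
    Step M N
  addColoop : ∀ {n} (M : OM n) (N : OM (suc n)) (i : Fin (suc n)) →
    (∀ X → Circ N X ⇔ (Σ (SignVec n) λ Y → X ≡ insertAt Y i zer × Circ M Y)) →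
    Step M N
  remove : ∀ {n} (M : OM (suc n)) (N : OM n) (e : Fin (suc n)) →
    (IsLoop M e ⊎ IsColoop M e) →
    (∀ Y → Circ N Y ⇔ Circ M (insertAt Y e zer)) →
    Step M N

data Obtained : ∀ {n m} → OM n → OM m → Set₁ where
  done : ∀ {n} (M : OM n) → Obtained M M
  step : ∀ {n m k} {M : OM n} {N : OM m} {P : OM k} →
         Step M N → Obtained N P → Obtained M P

-- Write a subset of E ⊔ {i} as a subset of E together with the bit "i ∈ I".
-- If i is a loop, the circuits ±({i},∅) force separated sets to agree on that
-- bit, and apart from this separation ignores i; so a maximal separated
-- collection over E ⊔ {i} is one layer of a maximal collection over E, of the
-- same size. If i is a coloop no circuit sees i, so a maximal collection is
-- closed under toggling i and consists of both layers of a maximal collection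
-- over E, of twice its size. Either way maximal collections and their sizes
-- correspond, so purity transfers in both directions, which covers removal as
-- well as addition. The only use of the circuit axioms is that, by (C2), the
-- circuits through a loop e are just ±({e},∅).
module Submission where

open import Defs
open import Data.Bool using (Bool; true; false)
open import Data.Bool.Properties using (_≟_)
open import Data.Empty using (⊥-elim)
open import Data.Fin using (Fin; zero; suc; punchIn) renaming (_≟_ to _≟F_)
open import Data.Fin.Properties using (punchIn-punchOut)
open import Data.Fin.Subset using (Subset) renaming (_∈_ to _∈ₛ_; _∉_ to _∉ₛ_)
open import Data.List using (List; []; _∷_; [_]; length; map; filter; _++_)
open import Data.List.Properties using (length-map; length-++; filter-all)
open import Data.List.Membership.Propositional using (_∈_)
open import Data.List.Membership.Propositional.Properties
  using (∈-map⁺; ∈-map⁻; ∈-map∘filter⁺; ∈-map∘filter⁻; ∈-++⁺ˡ; ∈-++⁺ʳ; ∈-++⁻)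
import Data.List.Membership.DecPropositional as DecMembership
open import Data.List.Relation.Binary.Subset.Propositional using (_⊆_)
open import Data.List.Relation.Unary.All as All using (All; []; _∷_)
import Data.List.Relation.Unary.All.Properties as All
open import Data.List.Relation.Unary.Any using (here; there)
open import Data.List.Relation.Unary.Unique.Propositional using (Unique; []; _∷_)
import Data.List.Relation.Unary.Unique.Propositional.Properties as Unique
open import Data.Nat using (ℕ; suc; _+_; _*_; _≤_; z≤n)
open import Data.Nat.Properties using (+-suc; +-identityʳ; +-mono-≤; *-cancelˡ-≤)
open import Data.Product using (_×_; _,_; proj₁; proj₂; ∃-syntax)
open import Data.Sum using (_⊎_; inj₁; inj₂)
open import Data.Vec using (Vec; _∷_; lookup; insertAt; removeAt; replicate; _[_]≔_)
open import Data.Vec.Properties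
  using (insertAt-lookup; insertAt-punchIn; insertAt-removeAt; removeAt-insertAt; lookup-replicate;
         lookup-map; map-insertAt; map-replicate; []=⇒lookup; lookup⇒[]=; ≡-dec)
open import Function.Bundles using (_⇔_; mk⇔; Equivalence)
open Equivalence using (to; from)
open import Relation.Binary.Definitions using (DecidableEquality)
open import Relation.Binary.PropositionalEquality
  using (_≡_; _≢_; refl; sym; trans; cong; cong₂; subst; subst₂; module ≡-Reasoning)
open import Relation.Nullary using (¬_; yes; no)

-- A separated collection is a clique of the separation relation (diagonal
-- included), and `Pure M` unfolds to `CliquePure (Separated M)`.
module _ {A : Set} where

  Clique : (A → A → Set) → List A → Set
  Clique R C = ∀ x y → x ∈ C → y ∈ C → R x y

  MaximalClique : (A → A → Set) → List A → Set
  MaximalClique R C = Clique R C × (∀ D → Unique D → Clique R D → C ⊆ D → D ⊆ C)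

  CliquePure : (A → A → Set) → Set
  CliquePure R = ∀ C → Unique C → MaximalClique R C →
                 ∀ D → Unique D → Clique R D → length D ≤ length C

  clique-[_] : ∀ {R} {y : A} → R y y → Clique R [ y ]
  clique-[ Ryy ] _ _ (here refl) (here refl) = Ryy

  ¬maximalClique-[] : ∀ {R} {y : A} → R y y → ¬ MaximalClique R []
  ¬maximalClique-[] {y = y} Ryy (_ , maximal)
    with () ← maximal [ y ] ([] ∷ []) clique-[ Ryy ] (λ ()) (here refl)

  maximalClique-∋ : DecidableEquality A → ∀ {R} {C} {y : A} → Unique C → MaximalClique R C →
                    R y y → (∀ c → c ∈ C → R y c × R c y) → y ∈ C
  maximalClique-∋ _≟A_ {R} {C} {y} uC (clique , maximal) Ryy compatible
    with DecMembership._∈?_ _≟A_ y C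
  ... | yes y∈C = y∈C
  ... | no  y∉C =
    ⊥-elim (y∉C (maximal (y ∷ C) (All.¬Any⇒All¬ C y∉C ∷ uC) clique′ there (here refl)))
    where
    clique′ : Clique R (y ∷ C)
    clique′ _ _ (here refl) (here refl) = Ryy
    clique′ _ c (here refl) (there c∈C) = proj₁ (compatible c c∈C)
    clique′ c _ (there c∈C) (here refl) = proj₂ (compatible c c∈C)
    clique′ c d (there c∈C) (there d∈C) = clique c d c∈C d∈C

-- A ≅ B × Bool: a subset of E ⊔ {i} is a subset of E plus the bit for i.
module Splitting {A B : Set} (_≟A_ : DecidableEquality A) (_≟B_ : DecidableEquality B)
  (restrict : A → B) (bit : A → Bool) (extend : B → Bool → A)
  (restrict-extend : ∀ y b → restrict (extend y b) ≡ y)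
  (bit-extend : ∀ y b → bit (extend y b) ≡ b)
  (extend-restrict : ∀ x → extend (restrict x) (bit x) ≡ x) where

  extend-restrict′ : ∀ {x b} → bit x ≡ b → extend (restrict x) b ≡ x
  extend-restrict′ {x} refl = extend-restrict x

  fibre : Bool → List A → List B
  fibre b C = map restrict (filter (λ x → bit x ≟ b) C)

  layer : Bool → List B → List A
  layer b = map (λ y → extend y b)

  ∈-fibre⁺ : ∀ {b C x} → x ∈ C → bit x ≡ b → restrict x ∈ fibre b C
  ∈-fibre⁺ {b} x∈C bx≡b = ∈-map∘filter⁺ restrict (λ x → bit x ≟ b) (_ , x∈C , refl , bx≡b)

  ∈-fibre⁻ : ∀ {b C y} → y ∈ fibre b C → ∃[ x ] x ∈ C × y ≡ restrict x × bit x ≡ b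
  ∈-fibre⁻ {b} = ∈-map∘filter⁻ restrict (λ x → bit x ≟ b)

  ∈-layer⁺ : ∀ {b D y} → y ∈ D → extend y b ∈ layer b D
  ∈-layer⁺ {b} = ∈-map⁺ (λ y → extend y b)

  ∈-layer⁻ : ∀ {b D x} → x ∈ layer b D → restrict x ∈ D × bit x ≡ b
  ∈-layer⁻ {b} x∈ with ∈-map⁻ (λ y → extend y b) x∈
  ... | y , y∈D , refl = subst (_∈ _) (sym (restrict-extend y b)) y∈D , bit-extend y b

  fibre-unique : ∀ b {C} → Unique C → Unique (fibre b C)
  fibre-unique b {C} uC =
    go (Unique.filter⁺ (λ x → bit x ≟ b) uC) (All.all-filter (λ x → bit x ≟ b) C)
    where
    go : ∀ {xs} → Unique xs → All (λ x → bit x ≡ b) xs → Unique (map restrict xs)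
    go []           []           = []
    go (x∉xs ∷ uxs) (bx ∷ bxs) = All.map⁺ (All.zipWith distinct (x∉xs , bxs)) ∷ go uxs bxs
      where
      distinct : ∀ {y} → _ ≢ y × bit y ≡ b → restrict _ ≢ restrict y
      distinct (x≢y , by) rx≡ry =
        x≢y (trans (sym (extend-restrict′ bx))
                   (trans (cong (λ z → extend z b) rx≡ry) (extend-restrict′ by)))

  layer-unique : ∀ b {D} → Unique D → Unique (layer b D)
  layer-unique b = Unique.map⁺ λ {y} {y′} eq →
    trans (sym (restrict-extend y b)) (trans (cong restrict eq) (restrict-extend y′ b))

  length-fibre : ∀ b {C} → All (λ x → bit x ≡ b) C → length (fibre b C) ≡ length C
  length-fibre b {C} all = trans (length-map restrict (filter (λ x → bit x ≟ b) C))
                                 (cong length (filter-all (λ x → bit x ≟ b) all))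

  length-fibres : ∀ C → length (fibre false C) + length (fibre true C) ≡ length C
  length-fibres []      = refl
  length-fibres (x ∷ C) with bit x
  ... | false = cong suc (length-fibres C)
  ... | true  = trans (+-suc _ _) (cong suc (length-fibres C))

  ∈-fibre-extend : ∀ {b C y} → extend y b ∈ C → y ∈ fibre b C
  ∈-fibre-extend {b} {y = y} e∈C = subst (_∈ _) (restrict-extend y b) (∈-fibre⁺ e∈C (bit-extend y b))

  ∈-layer-restrict : ∀ {b D x} → restrict x ∈ D → bit x ≡ b → x ∈ layer b D
  ∈-layer-restrict r∈D bx≡b = subst (_∈ _) (extend-restrict′ bx≡b) (∈-layer⁺ r∈D)

  clique-fibre : ∀ {RA RB} → (∀ {x y} → RA x y → RB (restrict x) (restrict y)) →
                 ∀ b {C} → Clique RA C → Clique RB (fibre b C)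
  clique-fibre related b cl _ _ y∈ y′∈ with ∈-fibre⁻ y∈ | ∈-fibre⁻ y′∈
  ... | x , x∈ , refl , _ | x′ , x′∈ , refl , _ = related (cl x x′ x∈ x′∈)

  module BitFixed (RA : A → A → Set) (RB : B → B → Set)
    (related⁻ : ∀ {x y} → RA x y → bit x ≡ bit y × RB (restrict x) (restrict y))
    (related⁺ : ∀ {x y} → bit x ≡ bit y → RB (restrict x) (restrict y) → RA x y) where

    restrict-related : ∀ {x y} → RA x y → RB (restrict x) (restrict y)
    restrict-related r = proj₂ (related⁻ r)

    clique-layer : ∀ b {D} → Clique RB D → Clique RA (layer b D)
    clique-layer b cl _ _ x∈ x′∈ with ∈-layer⁻ x∈ | ∈-layer⁻ x′∈
    ... | y∈ , bx | y′∈ , bx′ = related⁺ (trans bx (sym bx′)) (cl _ _ y∈ y′∈)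

    clique-bit : ∀ {C x y} → Clique RA C → x ∈ C → y ∈ C → bit x ≡ bit y
    clique-bit cl x∈ y∈ = proj₁ (related⁻ (cl _ _ x∈ y∈))

    fibre-maximal : ∀ {C c} → MaximalClique RA C → c ∈ C → MaximalClique RB (fibre (bit c) C)
    fibre-maximal {C} {c} (cl , maximal) c∈C = clique-fibre restrict-related (bit c) cl , maximal′
      where
      maximal′ : ∀ D → Unique D → Clique RB D → fibre (bit c) C ⊆ D → D ⊆ fibre (bit c) C
      maximal′ D uD clD fibre⊆D y∈D = ∈-fibre-extend (layer⊆C (∈-layer⁺ y∈D))
        where
        C⊆layer : C ⊆ layer (bit c) D
        C⊆layer x∈C = ∈-layer-restrict (fibre⊆D (∈-fibre⁺ x∈C bx≡bc)) bx≡bc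
          where bx≡bc = clique-bit cl x∈C c∈C
        layer⊆C : layer (bit c) D ⊆ C
        layer⊆C = maximal (layer (bit c) D) (layer-unique (bit c) uD) (clique-layer (bit c) clD) C⊆layer

    bit-above-layer : ∀ {b C D d} → MaximalClique RB C → Clique RA D →
                      layer b C ⊆ D → d ∈ D → bit d ≡ b
    bit-above-layer {C = []} maxC clD _ d∈D =
      ⊥-elim (¬maximalClique-[] (restrict-related (clD _ _ d∈D d∈D)) maxC)
    bit-above-layer {b} {C = c ∷ _} _ clD layer⊆D d∈D =
      trans (clique-bit clD d∈D (layer⊆D (here refl))) (bit-extend c b)

    layer-maximal : ∀ b {C} → MaximalClique RB C → MaximalClique RA (layer b C)
    layer-maximal b {C} maxC@(cl , maximal) = clique-layer b cl , maximal′
      where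
      maximal′ : ∀ D → Unique D → Clique RA D → layer b C ⊆ D → D ⊆ layer b C
      maximal′ D uD clD layer⊆D d∈D = ∈-layer-restrict (fibre⊆C (∈-fibre⁺ d∈D bd≡b)) bd≡b
        where
        bd≡b = bit-above-layer maxC clD layer⊆D d∈D
        C⊆fibre : C ⊆ fibre b D
        C⊆fibre c∈C = ∈-fibre-extend (layer⊆D (∈-layer⁺ c∈C))
        fibre⊆C : fibre b D ⊆ C
        fibre⊆C = maximal (fibre b D) (fibre-unique b uD) (clique-fibre restrict-related b clD) C⊆fibre

    pure⁺ : CliquePure RB → CliquePure RA
    pure⁺ pureB C       uC maxC []      uD clD = z≤n
    pure⁺ pureB []      uC maxC (d ∷ D) uD clD =
      ⊥-elim (¬maximalClique-[] (clD d d (here refl) (here refl)) maxC)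
    pure⁺ pureB (c ∷ C) uC maxC (d ∷ D) uD clD =
      subst₂ _≤_ (length-fibre (bit d) (constantBit clD)) (length-fibre (bit c) (constantBit (proj₁ maxC)))
        (pureB (fibre (bit c) (c ∷ C)) (fibre-unique (bit c) uC) (fibre-maximal maxC (here refl))
               (fibre (bit d) (d ∷ D)) (fibre-unique (bit d) uD)
               (clique-fibre restrict-related (bit d) clD))
      where
      constantBit : ∀ {x xs} → Clique RA (x ∷ xs) → All (λ y → bit y ≡ bit x) (x ∷ xs)
      constantBit cl = All.tabulate (λ y∈ → clique-bit cl y∈ (here refl))

    pure⁻ : CliquePure RA → CliquePure RB
    pure⁻ pureA C uC maxC D uD clD =
      subst₂ _≤_ (length-map _ D) (length-map _ C)
        (pureA (layer false C) (layer-unique false uC) (layer-maximal false maxC)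
               (layer false D) (layer-unique false uD) (clique-layer false clD))

  module BitFree (RA : A → A → Set) (RB : B → B → Set)
    (related⁻ : ∀ {x y} → RA x y → RB (restrict x) (restrict y))
    (related⁺ : ∀ {x y} → RB (restrict x) (restrict y) → RA x y) where

    related-resp : ∀ {x x′ y y′} → restrict x ≡ restrict x′ → restrict y ≡ restrict y′ →
                   RA x y → RA x′ y′
    related-resp x≡ y≡ r = related⁺ (subst₂ RB x≡ y≡ (related⁻ r))

    maximal-resp : ∀ {C x x′} → Unique C → MaximalClique RA C →
                   x ∈ C → restrict x ≡ restrict x′ → x′ ∈ C
    maximal-resp uC maxC@(cl , _) x∈C x≡x′ = maximalClique-∋ _≟A_ uC maxC
      (related-resp x≡x′ x≡x′ (cl _ _ x∈C x∈C))
      (λ c c∈C → related-resp x≡x′ refl (cl _ _ x∈C c∈C)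
               , related-resp refl x≡x′ (cl _ _ c∈C x∈C))

    fibre-maximal : ∀ b {C} → Unique C → MaximalClique RA C → MaximalClique RB (fibre b C)
    fibre-maximal b {C} uC maxC@(cl , _) = clique-fibre related⁻ b cl , maximal′
      where
      maximal′ : ∀ D → Unique D → Clique RB D → fibre b C ⊆ D → D ⊆ fibre b C
      maximal′ D _ clD fibre⊆D {y} y∈D = ∈-fibre-extend (maximalClique-∋ _≟A_ uC maxC
        (related⁺ (subst₂ RB y≡ y≡ (clD y y y∈D y∈D)))
        (λ c c∈C → related⁺ (subst (λ z → RB z _) y≡ (clD _ _ y∈D (restrict∈D c∈C)))
                 , related⁺ (subst (RB _) y≡ (clD _ _ (restrict∈D c∈C) y∈D))))
        where
        y≡ = sym (restrict-extend y b)
        restrict∈D : ∀ {c} → c ∈ C → restrict c ∈ D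
        restrict∈D c∈C =
          fibre⊆D (∈-fibre-extend (maximal-resp uC maxC c∈C (sym (restrict-extend _ b))))

    pure⁺ : CliquePure RB → CliquePure RA
    pure⁺ pureB C uC maxC D uD clD =
      subst₂ _≤_ (length-fibres D) (length-fibres C) (+-mono-≤ (bound false) (bound true))
      where
      bound : ∀ b → length (fibre b D) ≤ length (fibre b C)
      bound b = pureB (fibre b C) (fibre-unique b uC) (fibre-maximal b uC maxC)
                      (fibre b D) (fibre-unique b uD) (clique-fibre related⁻ b clD)

    bothLayers : List B → List A
    bothLayers C = layer false C ++ layer true C

    ∈-bothLayers⁺ : ∀ {C x} → restrict x ∈ C → x ∈ bothLayers C
    ∈-bothLayers⁺ {C} {x} r∈C with bit x in bx
    ... | false = ∈-++⁺ˡ (∈-layer-restrict r∈C bx)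
    ... | true  = ∈-++⁺ʳ (layer false C) (∈-layer-restrict r∈C bx)

    ∈-bothLayers⁻ : ∀ {C x} → x ∈ bothLayers C → restrict x ∈ C
    ∈-bothLayers⁻ {C} x∈ with ∈-++⁻ (layer false C) x∈
    ... | inj₁ x∈false = proj₁ (∈-layer⁻ x∈false)
    ... | inj₂ x∈true  = proj₁ (∈-layer⁻ x∈true)

    bothLayers-unique : ∀ {C} → Unique C → Unique (bothLayers C)
    bothLayers-unique uC = Unique.++⁺ (layer-unique false uC) (layer-unique true uC)
      λ (x∈false , x∈true) →
        false≢true (trans (sym (proj₂ (∈-layer⁻ x∈false))) (proj₂ (∈-layer⁻ x∈true)))
      where
      false≢true : false ≢ true
      false≢true ()

    clique-bothLayers : ∀ {C} → Clique RB C → Clique RA (bothLayers C)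
    clique-bothLayers cl _ _ x∈ y∈ = related⁺ (cl _ _ (∈-bothLayers⁻ x∈) (∈-bothLayers⁻ y∈))

    length-bothLayers : ∀ C → length (bothLayers C) ≡ 2 * length C
    length-bothLayers C = begin
      length (layer false C ++ layer true C)         ≡⟨ length-++ (layer false C) ⟩
      length (layer false C) + length (layer true C) ≡⟨ cong₂ _+_ (length-map _ C) (length-map _ C) ⟩
      length C + length C                            ≡⟨ cong (length C +_) (sym (+-identityʳ (length C))) ⟩
      2 * length C                                   ∎
      where open ≡-Reasoning

    bothLayers-maximal : ∀ {C} → Unique C → MaximalClique RB C → MaximalClique RA (bothLayers C)
    bothLayers-maximal {C} uC maxC@(cl , _) = clique-bothLayers cl , maximal′
      where
      maximal′ : ∀ D → Unique D → Clique RA D → bothLayers C ⊆ D → D ⊆ bothLayers C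
      maximal′ D _ clD layers⊆D d∈D = ∈-bothLayers⁺ (maximalClique-∋ _≟B_ uC maxC
        (related⁻ (clD _ _ d∈D d∈D))
        (λ c c∈C → subst (RB _) (restrict-extend c false) (related⁻ (clD _ _ d∈D (extend∈D c∈C)))
                 , subst (λ z → RB z _) (restrict-extend c false) (related⁻ (clD _ _ (extend∈D c∈C) d∈D))))
        where
        extend∈D : ∀ {c} → c ∈ C → extend c false ∈ D
        extend∈D c∈C = layers⊆D (∈-++⁺ˡ (∈-layer⁺ c∈C))

    pure⁻ : CliquePure RA → CliquePure RB
    pure⁻ pureA C uC maxC D uD clD = *-cancelˡ-≤ 2
      (subst₂ _≤_ (length-bothLayers D) (length-bothLayers C)
        (pureA (bothLayers C) (bothLayers-unique uC) (bothLayers-maximal uC maxC)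
               (bothLayers D) (bothLayers-unique uD) (clique-bothLayers clD)))

-- `Separated M I J` is by definition `¬ ∃ X. Circ M X × Obstructs X I J`.
SignedIn : ∀ {n} → Sign → SignVec n → Subset n → Subset n → Set
SignedIn s X I J = ∀ e → lookup X e ≡ s → e ∈ₛ I × e ∉ₛ J

Obstructs : ∀ {n} → SignVec n → Subset n → Subset n → Set
Obstructs X I J = SignedIn pos X I J × SignedIn neg X J I

data PunchInView {n} (i : Fin (suc n)) : Fin (suc n) → Set where
  at        : PunchInView i i
  punchedIn : (f : Fin n) → PunchInView i (punchIn i f)

punchInView : ∀ {n} (i e : Fin (suc n)) → PunchInView i e
punchInView i e with e ≟F i
... | yes refl = at
... | no  e≢i  = subst (PunchInView i) (punchIn-punchOut (λ i≡e → e≢i (sym i≡e))) (punchedIn _)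

true≢false : true ≢ false
true≢false ()

module AtPosition {n : ℕ} (i : Fin (suc n)) where

  lookup-removeAt : ∀ {A : Set} (xs : Vec A (suc n)) f → lookup (removeAt xs i) f ≡ lookup xs (punchIn i f)
  lookup-removeAt xs f = trans (sym (insertAt-punchIn (removeAt xs i) i (lookup xs i) f))
                               (cong (λ v → lookup v (punchIn i f)) (insertAt-removeAt xs i))

  ∈-removeAt⁺ : ∀ {I : Subset (suc n)} {f} → punchIn i f ∈ₛ I → f ∈ₛ removeAt I i
  ∈-removeAt⁺ {I} {f} p = lookup⇒[]= f _ (trans (lookup-removeAt I f) ([]=⇒lookup p))

  ∈-removeAt⁻ : ∀ {I : Subset (suc n)} {f} → f ∈ₛ removeAt I i → punchIn i f ∈ₛ I
  ∈-removeAt⁻ {I} {f} p = lookup⇒[]= (punchIn i f) _ (trans (sym (lookup-removeAt I f)) ([]=⇒lookup p))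

  signedIn-insertAt⁻ : ∀ {s Y I J} →
    SignedIn s (insertAt Y i zer) I J → SignedIn s Y (removeAt I i) (removeAt J i)
  signedIn-insertAt⁻ {Y = Y} signed f Yf≡s
    with e∈I , e∉J ← signed (punchIn i f) (trans (insertAt-punchIn Y i zer f) Yf≡s)
    = ∈-removeAt⁺ e∈I , λ f∈J → e∉J (∈-removeAt⁻ f∈J)

  signedIn-insertAt⁺ : ∀ {s Y I J} → s ≢ zer →
    SignedIn s Y (removeAt I i) (removeAt J i) → SignedIn s (insertAt Y i zer) I J
  signedIn-insertAt⁺ {Y = Y} s≢zer signed e Xe≡s with punchInView i e
  ... | at          = ⊥-elim (s≢zer (trans (sym Xe≡s) (insertAt-lookup Y i zer)))
  ... | punchedIn f with f∈I , f∉J ← signed f (trans (sym (insertAt-punchIn Y i zer f)) Xe≡s)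
    = ∈-removeAt⁻ f∈I , λ e∈J → f∉J (∈-removeAt⁺ e∈J)

  obstructs-insertAt⁻ : ∀ {Y I J} →
    Obstructs (insertAt Y i zer) I J → Obstructs Y (removeAt I i) (removeAt J i)
  obstructs-insertAt⁻ (signed⁺ , signed⁻) = signedIn-insertAt⁻ signed⁺ , signedIn-insertAt⁻ signed⁻

  obstructs-insertAt⁺ : ∀ {Y I J} →
    Obstructs Y (removeAt I i) (removeAt J i) → Obstructs (insertAt Y i zer) I J
  obstructs-insertAt⁺ (signed⁺ , signed⁻) =
    signedIn-insertAt⁺ (λ ()) signed⁺ , signedIn-insertAt⁺ (λ ()) signed⁻

  unit : Sign → SignVec (suc n)
  unit s = insertAt (replicate n zer) i s

  lookup-unit-punchIn : ∀ s f → lookup (unit s) (punchIn i f) ≡ zer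
  lookup-unit-punchIn s f = trans (insertAt-punchIn (replicate n zer) i s f) (lookup-replicate f zer)

  signedIn-unit : ∀ {s t I J} → t ≢ zer → (s ≡ t → i ∈ₛ I × i ∉ₛ J) → SignedIn t (unit s) I J
  signedIn-unit {s} t≢zer at-i e Xe≡t with punchInView i e
  ... | at          = at-i (trans (sym (insertAt-lookup (replicate n zer) i s)) Xe≡t)
  ... | punchedIn f = ⊥-elim (t≢zer (trans (sym Xe≡t) (lookup-unit-punchIn s f)))

  unit-support : ∀ {s X} → s ≢ zer → lookup X i ≡ s →
                 ∀ e → lookup (unit s) e ≢ zer → lookup X e ≢ zer
  unit-support s≢zer Xi≡s e Ue≢zer with punchInView i e
  ... | at          = λ Xi≡zer → s≢zer (trans (sym Xi≡s) Xi≡zer)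
  ... | punchedIn f = ⊥-elim (Ue≢zer (lookup-unit-punchIn _ f))

  ∈-∉-at : ∀ {I J : Subset (suc n)} → lookup I i ≡ true → lookup J i ≡ false → i ∈ₛ I × i ∉ₛ J
  ∈-∉-at Ii Ji = lookup⇒[]= i _ Ii , λ i∈J → true≢false (trans (sym ([]=⇒lookup i∈J)) Ji)

  obstructs-unit-pos : ∀ {I J} → lookup I i ≡ true → lookup J i ≡ false → Obstructs (unit pos) I J
  obstructs-unit-pos Ii Ji = signedIn-unit (λ ()) (λ _ → ∈-∉-at Ii Ji) , signedIn-unit (λ ()) (λ ())

  obstructs-unit-neg : ∀ {I J} → lookup I i ≡ false → lookup J i ≡ true → Obstructs (unit neg) I J
  obstructs-unit-neg Ii Ji = signedIn-unit (λ ()) (λ ()) , signedIn-unit (λ ()) (λ _ → ∈-∉-at Ji Ii)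

  signedIn-unit⇒bit≢ : ∀ {s I J} → s ≢ zer → SignedIn s (unit s) I J → lookup I i ≢ lookup J i
  signedIn-unit⇒bit≢ {s} s≢zer signed Ii≡Ji
    with i∈I , i∉J ← signed i (insertAt-lookup (replicate n zer) i s)
    = i∉J (lookup⇒[]= i _ (trans (sym Ii≡Ji) ([]=⇒lookup i∈I)))

  record LoopExtension (S : OM n) (N : OM (suc n)) : Set where
    field
      circuit-insertAt : ∀ {Y} → Circ S Y → Circ N (insertAt Y i zer)
      circuit-unit-pos : Circ N (unit pos)
      circuit-unit-neg : Circ N (unit neg)
      circuit-cases    : ∀ {X} → Circ N X →
        (∃[ Y ] X ≡ insertAt Y i zer × Circ S Y) ⊎ X ≡ unit pos ⊎ X ≡ unit neg

  record ColoopExtension (S : OM n) (N : OM (suc n)) : Set where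
    field
      circuit-insertAt : ∀ {Y} → Circ S Y → Circ N (insertAt Y i zer)
      circuit-cases    : ∀ {X} → Circ N X → ∃[ Y ] X ≡ insertAt Y i zer × Circ S Y

  module _ {S : OM n} {N : OM (suc n)} where

    separated-removeAt : (∀ {Y} → Circ S Y → Circ N (insertAt Y i zer)) →
      ∀ {I J} → Separated N I J → Separated S (removeAt I i) (removeAt J i)
    separated-removeAt lift sep (Y , cY , obs) = sep (insertAt Y i zer , lift cY , obstructs-insertAt⁺ obs)

    ¬obstructs-insertAt : ∀ {I J Y} → Separated S (removeAt I i) (removeAt J i) → Circ S Y →
      ¬ Obstructs (insertAt Y i zer) I J
    ¬obstructs-insertAt sep cY obs = sep (_ , cY , obstructs-insertAt⁻ obs)

    module _ (ext : LoopExtension S N) where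
      open LoopExtension ext

      separated⇒lookup≡ : ∀ {I J} → Separated N I J → lookup I i ≡ lookup J i
      separated⇒lookup≡ {I} {J} sep with lookup I i in Ii | lookup J i in Ji
      ... | true  | true  = refl
      ... | false | false = refl
      ... | true  | false = ⊥-elim (sep (unit pos , circuit-unit-pos , obstructs-unit-pos Ii Ji))
      ... | false | true  = ⊥-elim (sep (unit neg , circuit-unit-neg , obstructs-unit-neg Ii Ji))

      separated-insertAt-loop : ∀ {I J} → lookup I i ≡ lookup J i →
        Separated S (removeAt I i) (removeAt J i) → Separated N I J
      separated-insertAt-loop sameBit sep (X , cX , obs) with circuit-cases cX
      ... | inj₁ (Y , refl , cY) = ¬obstructs-insertAt sep cY obs
      ... | inj₂ (inj₁ refl)     = signedIn-unit⇒bit≢ (λ ()) (proj₁ obs) sameBit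
      ... | inj₂ (inj₂ refl)     = signedIn-unit⇒bit≢ (λ ()) (proj₂ obs) (sym sameBit)

    module _ (ext : ColoopExtension S N) where
      open ColoopExtension ext

      separated-insertAt-coloop : ∀ {I J} → Separated S (removeAt I i) (removeAt J i) → Separated N I J
      separated-insertAt-coloop sep (X , cX , obs) with circuit-cases cX
      ... | Y , refl , cY = ¬obstructs-insertAt sep cY obs

  module Subsets = Splitting (≡-dec _≟_) (≡-dec _≟_)
    (λ I → removeAt I i) (λ I → lookup I i) (λ I b → insertAt I i b)
    (λ I b → removeAt-insertAt I i b) (λ I b → insertAt-lookup I i b) (λ I → insertAt-removeAt I i)

  loopExtension-pure : ∀ {S N} → LoopExtension S N → Pure S ⇔ Pure N
  loopExtension-pure {S} {N} ext = mk⇔ Loop.pure⁺ Loop.pure⁻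
    where
    module Loop = Subsets.BitFixed (Separated N) (Separated S)
      (λ sep → separated⇒lookup≡ ext sep
             , separated-removeAt {S} {N} (LoopExtension.circuit-insertAt ext) sep)
      (separated-insertAt-loop ext)

  coloopExtension-pure : ∀ {S N} → ColoopExtension S N → Pure S ⇔ Pure N
  coloopExtension-pure {S} {N} ext = mk⇔ Coloop.pure⁺ Coloop.pure⁻
    where
    module Coloop = Subsets.BitFree (Separated N) (Separated S)
      (separated-removeAt {S} {N} (ColoopExtension.circuit-insertAt ext)) (separated-insertAt-coloop ext)

replicate-[]≔ : ∀ n (e : Fin (suc n)) (s : Sign) →
  replicate (suc n) zer [ e ]≔ s ≡ insertAt (replicate n zer) e s
replicate-[]≔ n       zero    s = refl
replicate-[]≔ (suc n) (suc e) s = cong (zer ∷_) (replicate-[]≔ n e s)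

s≢opp-s : ∀ {s} → s ≢ zer → s ≢ opp s
s≢opp-s {pos} _ ()
s≢opp-s {neg} _ ()
s≢opp-s {zer} s≢zer _ = s≢zer refl

module Deletion {n : ℕ} (M : OM (suc n)) (e : Fin (suc n)) where
  open AtPosition e

  negV-unit-pos : negV (unit pos) ≡ unit neg
  negV-unit-pos = trans (map-insertAt opp pos (replicate n zer) e)
                        (cong (λ v → insertAt v e neg) (map-replicate opp zer n))

  circuit-through-unit : ∀ {s X} → s ≢ zer → Circ M (unit s) → Circ M X → lookup X e ≡ s → X ≡ unit s
  circuit-through-unit {s} {X} s≢zer cU cX Xe≡s
    with C2 M (unit s) X cU cX (unit-support {X = X} s≢zer Xe≡s)
  ... | inj₁ U≡X  = sym U≡X
  ... | inj₂ U≡-X = ⊥-elim (s≢opp-s s≢zer (begin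
    s                     ≡⟨ sym (insertAt-lookup (replicate n zer) e s) ⟩
    lookup (unit s) e     ≡⟨ cong (λ v → lookup v e) U≡-X ⟩
    lookup (negV X) e     ≡⟨ lookup-map e opp X ⟩
    opp (lookup X e)      ≡⟨ cong opp Xe≡s ⟩
    opp s                 ∎))
    where open ≡-Reasoning

  module _ {N : OM n} (deletion : ∀ Y → Circ N Y ⇔ Circ M (insertAt Y e zer)) where

    circuit-avoiding : ∀ {X} → Circ M X → lookup X e ≡ zer → ∃[ Y ] X ≡ insertAt Y e zer × Circ N Y
    circuit-avoiding {X} cX Xe≡zer = removeAt X e , X≡ , from (deletion _) (subst (Circ M) X≡ cX)
      where
      X≡ : X ≡ insertAt (removeAt X e) e zer
      X≡ = trans (sym (insertAt-removeAt X e)) (cong (insertAt (removeAt X e) e) Xe≡zer)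

    deleteLoop-extension : IsLoop M e → LoopExtension N M
    deleteLoop-extension loop = record
      { circuit-insertAt = to (deletion _)
      ; circuit-unit-pos = cPos
      ; circuit-unit-neg = cNeg
      ; circuit-cases    = cases
      }
      where
      cPos : Circ M (unit pos)
      cPos = subst (Circ M) (replicate-[]≔ n e pos) loop
      cNeg : Circ M (unit neg)
      cNeg = subst (Circ M) negV-unit-pos (C1 M _ cPos)
      cases : ∀ {X} → Circ M X →
              (∃[ Y ] X ≡ insertAt Y e zer × Circ N Y) ⊎ X ≡ unit pos ⊎ X ≡ unit neg
      cases {X} cX with lookup X e in Xe
      ... | zer = inj₁ (circuit-avoiding cX Xe)
      ... | pos = inj₂ (inj₁ (circuit-through-unit (λ ()) cPos cX Xe))
      ... | neg = inj₂ (inj₂ (circuit-through-unit (λ ()) cNeg cX Xe))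

    deleteColoop-extension : IsColoop M e → ColoopExtension N M
    deleteColoop-extension coloop = record
      { circuit-insertAt = to (deletion _)
      ; circuit-cases    = λ cX → circuit-avoiding cX (coloop _ cX)
      }

open AtPosition using (loopExtension-pure; coloopExtension-pure)

step-pure : ∀ {n m} {M : OM n} {N : OM m} → Step M N → Pure M → Pure N
step-pure (addLoop M N i circuits) = to (loopExtension-pure i {M} {N} (record
  { circuit-insertAt = λ cY → from (circuits _) (inj₁ (_ , refl , cY))
  ; circuit-unit-pos = from (circuits _) (inj₂ (inj₁ refl))
  ; circuit-unit-neg = from (circuits _) (inj₂ (inj₂ refl))
  ; circuit-cases    = to (circuits _)
  }))
step-pure (addColoop M N i circuits) = to (coloopExtension-pure i {M} {N} (record
  { circuit-insertAt = λ cY → from (circuits _) (_ , refl , cY)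
  ; circuit-cases    = to (circuits _)
  }))
step-pure (remove M N e (inj₁ loop) deletion) =
  from (loopExtension-pure e {N} {M} (Deletion.deleteLoop-extension M e deletion loop))
step-pure (remove M N e (inj₂ coloop) deletion) =
  from (coloopExtension-pure e {N} {M} (Deletion.deleteColoop-extension M e deletion coloop))

lemma4p1 : ∀ {n m} (M : OM n) (N : OM m) → Pure M → Obtained M N → Pure N
lemma4p1 M .M pure (done .M)     = pure
lemma4p1 M N  pure (step s rest) = lemma4p1 _ N (step-pure s pure) rest
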